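{- Let $\mathbf{T}=(\mathbf{T}(N))_{N\ge 0}$ with $\mathbf{T}(N)=s_{3/2}(N)\bmod 2$. If a finite word $w$ over $\{0,1\}$ occurs in $\mathbf{T}$, then its binary complement $w^*$, obtained from $w$ by replacing each $0$ by $1$ and each $1$ by $0$, also occurs in $\mathbf{T}$.
   Context: Every natural number $N$ can be written uniquely (ignoring leading zeros) as $N=\sum_{i=0}^{R} d_i (3/2)^i$ with digits $d_i\in\{0,1,2\}$; this is the base $3/2$ representation of $N$, and $s_{3/2}(N)=\sum_{i=0}^R d_i$ (with $s_{3/2}(0)=0$). A word $w$ occurs in a sequence $x$ if $w=x_jx_{j+1}\dots x_{j+|w|-1}$ for some $j\ge0$. -}

module Defs where

open import Data.Nat using (ℕ; zero; suc; _+_; _*_; _%_)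
open import Data.Fin using (Fin; toℕ)
open import Data.List using (List; []; _∷_; map)
open import Data.Nat.ListAction using (sum)
open import Data.Bool using (Bool; true; false; not)
open import Data.Rational.Unnormalised using (ℚᵘ; _≃_; mkℚᵘ; 0ℚᵘ)
import Data.Rational.Unnormalised as Q
open import Data.Integer using (+_)
open import Data.Product using (∃; _×_)
open import Relation.Binary.PropositionalEquality using (_≡_)

Digit : Set
Digit = Fin 3

threeHalves : ℚᵘ
threeHalves = mkℚᵘ (+ 3) 1

-- value of a little-endian digit list  d_0 d_1 ... d_R  in base 3/2:
-- Σ d_i (3/2)^i, computed by Horner's rule  d_0 + (3/2) * (value of rest)
val : List Digit → ℚᵘ
val [] = 0ℚᵘ
val (d ∷ ds) = mkℚᵘ (+ toℕ d) 0 Q.+ threeHalves Q.* val ds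

IsRep : List Digit → ℕ → Set
IsRep ds N = val ds ≃ mkℚᵘ (+ N) 0

digitSum : List Digit → ℕ
digitSum ds = sum (map toℕ ds)

parity : ℕ → Bool
parity n with n % 2
... | zero = false
... | suc _ = true

-- t is the sequence T(N) = s_{3/2}(N) mod 2: for every N, and every
-- (by uniqueness: the) base-3/2 representation ds of N, t N = digit sum of ds mod 2
IsT : (ℕ → Bool) → Set
IsT t = ∀ N (ds : List Digit) → IsRep ds N → t N ≡ parity (digitSum ds)

Occurs : List Bool → (ℕ → Bool) → Set
Occurs w x = ∃ λ j → go w j
  where
  go : List Bool → ℕ → Set
  go [] _ = Data.Unit.⊤
    where import Data.Unit
  go (b ∷ bs) j = (x j ≡ b) × go bs (suc j)

complement : List Bool → List Bool
complement = map not

-- Greedy expansion: N = (N mod 3) + (3/2)·(2⌊N/3⌋), so the digits of N are read off by iterating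
-- N ↦ 2⌊N/3⌋.  If this iteration reaches 0 from N within K steps, then adding 3^K·x to N only
-- adds 2^K·x at the point where the expansion of N has run out, so
-- s(N + 3^K x) = s(N) + s(2^K x) and T(N + 3^K x) = T(N) xor T(2^K x).
-- Choosing x, y with 1 + 3^K x = 2^K y gives T(2^K y) = 1 xor T(2^K x), so T(2^K z) = 1 for
-- z = x or z = y; then the shift by 3^K z complements T on [0, K], carrying every occurrence of
-- w inside [0, K] to an occurrence of its complement.
module Submission where

open import Defs
open import Data.Nat using (ℕ; zero; suc; _+_; _*_; _^_; _≤_; _<_; z≤n; s≤s; z<s; _/_; _%_)
open import Data.Nat.Properties
open import Algebra.Properties.CommutativeSemigroup *-commutativeSemigroup using (x∙yz≈y∙xz; x∙yz≈yx∙z)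
open import Data.Nat.DivMod using (_mod_; _divMod_; result; m%n<n; m≡m%n+[m/n]*n; m/n*n≤m; +-distrib-/-∣ʳ; m*n/n≡m; [m+kn]%n≡m%n)
open import Data.Nat.Divisibility using (n∣m*n)
import Data.Nat as ℕ
open import Data.Parity.Base as ℙ using (Parity; 0ℙ; 1ℙ)
open import Data.Parity.Properties using (+-homo-+)
open import Data.Nat.GeneralisedArithmetic using (iterate)
open import Data.Fin as Fin using (toℕ)
open import Data.Fin.Properties using (toℕ-fromℕ<)
open import Data.List using (List; []; _∷_; length)
open import Data.Bool using (Bool; true; false; not; _xor_)
open import Data.Bool.Properties using (xor-comm)
open import Data.Product using (Σ; ∃; _,_; proj₁)
open import Data.Unit using (tt)
open import Data.Integer using (+_)
import Data.Integer as ℤ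
open import Data.Integer.Properties using (pos-+; pos-*)
open import Data.Rational.Unnormalised using (mkℚᵘ; _≃_; *≡*)
import Data.Rational.Unnormalised as ℚᵘ
open import Data.Rational.Unnormalised.Properties using (≃-refl; ≃-reflexive; +-cong; *-congˡ; module ≃-Reasoning)
open import Relation.Binary.PropositionalEquality
import Data.Integer.Tactic.RingSolver as ℤ-Solver
import Data.Nat.Tactic.RingSolver as ℕ-Solver

digit+threeHalves*even : ∀ r k →
  mkℚᵘ (+ r) 0 ℚᵘ.+ threeHalves ℚᵘ.* mkℚᵘ (+ (2 * k)) 0 ≃ mkℚᵘ (+ (r + 3 * k)) 0
digit+threeHalves*even r k = *≡* (begin
    (+ r ℤ.* + 2 ℤ.+ (+ 3 ℤ.* + (2 * k)) ℤ.* + 1) ℤ.* + 1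
  ≡⟨ cong (λ z → (+ r ℤ.* + 2 ℤ.+ (+ 3 ℤ.* z) ℤ.* + 1) ℤ.* + 1) (pos-* 2 k) ⟩
    (+ r ℤ.* + 2 ℤ.+ (+ 3 ℤ.* (+ 2 ℤ.* + k)) ℤ.* + 1) ℤ.* + 1
  ≡⟨ normalise (+ r) (+ k) ⟩
    (+ r ℤ.+ + 3 ℤ.* + k) ℤ.* + 2
  ≡⟨ cong (λ z → (+ r ℤ.+ z) ℤ.* + 2) (pos-* 3 k) ⟨
    (+ r ℤ.+ + (3 * k)) ℤ.* + 2
  ≡⟨ cong (ℤ._* + 2) (pos-+ r (3 * k)) ⟨
    + (r + 3 * k) ℤ.* + 2
  ∎)
  where
  open ≡-Reasoning
  normalise : ∀ a b → (a ℤ.* + 2 ℤ.+ (+ 3 ℤ.* (+ 2 ℤ.* b)) ℤ.* + 1) ℤ.* + 1 ≡ (a ℤ.+ + 3 ℤ.* b) ℤ.* + 2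
  normalise = ℤ-Solver.solve-∀

rest : ℕ → ℕ
rest N = 2 * (N / 3)

greedyDigits : ℕ → ℕ → List Digit
greedyDigits zero    N = []
greedyDigits (suc f) N = N mod 3 ∷ greedyDigits f (rest N)

greedySum : ℕ → ℕ → ℕ
greedySum zero    N = 0
greedySum (suc f) N = N % 3 + greedySum f (rest N)

digitSum-greedyDigits : ∀ f N → digitSum (greedyDigits f N) ≡ greedySum f N
digitSum-greedyDigits zero    N = refl
digitSum-greedyDigits (suc f) N =
  cong₂ _+_ (toℕ-fromℕ< (m%n<n N 3)) (digitSum-greedyDigits f (rest N))

greedyDigits-isRep : ∀ f N → iterate rest N f ≡ 0 → IsRep (greedyDigits f N) N
greedyDigits-isRep zero    N refl = ≃-refl
greedyDigits-isRep (suc f) N restᶠ≡0 = begin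
    mkℚᵘ (+ toℕ (N mod 3)) 0 ℚᵘ.+ threeHalves ℚᵘ.* val (greedyDigits f (rest N))
  ≈⟨ +-cong (≃-reflexive (cong (λ d → mkℚᵘ (+ d) 0) (toℕ-fromℕ< (m%n<n N 3))))
            (*-congˡ {threeHalves} (greedyDigits-isRep f (rest N) restᶠ≡0)) ⟩
    mkℚᵘ (+ (N % 3)) 0 ℚᵘ.+ threeHalves ℚᵘ.* mkℚᵘ (+ rest N) 0
  ≈⟨ digit+threeHalves*even (N % 3) (N / 3) ⟩
    mkℚᵘ (+ (N % 3 + 3 * (N / 3))) 0
  ≈⟨ ≃-reflexive (cong (λ n → mkℚᵘ (+ n) 0) N%3+3*[N/3]≡N) ⟩
    mkℚᵘ (+ N) 0
  ∎
  where
  open ≃-Reasoning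
  N%3+3*[N/3]≡N : N % 3 + 3 * (N / 3) ≡ N
  N%3+3*[N/3]≡N = trans (cong (_+_ (N % 3)) (*-comm 3 (N / 3))) (sym (m≡m%n+[m/n]*n N 3))

rest-suc-≤ : ∀ n → rest (suc n) ≤ n
rest-suc-≤ n with suc n / 3 | m/n*n≤m (suc n) 3
... | zero  | _          = z≤n
... | suc q | 3[1+q]≤1+n = ≤-pred (begin
    suc (2 * suc q)        ≤⟨ m≤m+n (suc (2 * suc q)) q ⟩
    suc (2 * suc q) + q    ≡⟨ ℕ-Solver.solve (q ∷ []) ⟩
    suc q * 3              ≤⟨ 3[1+q]≤1+n ⟩
    suc n                  ∎)
  where open ≤-Reasoning

iterate-rest-vanishes : ∀ K N → N ≤ K → iterate rest N K ≡ 0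
iterate-rest-vanishes zero    zero    _       = refl
iterate-rest-vanishes (suc K) zero    _       = iterate-rest-vanishes K 0 z≤n
iterate-rest-vanishes (suc K) (suc n) (s≤s n≤K) =
  iterate-rest-vanishes K (rest (suc n)) (≤-trans (rest-suc-≤ n) n≤K)

rest-+-3* : ∀ N m → rest (N + 3 * m) ≡ rest N + 2 * m
rest-+-3* N m = begin
  2 * ((N + 3 * m) / 3)   ≡⟨ cong (λ k → 2 * ((N + k) / 3)) (*-comm 3 m) ⟩
  2 * ((N + m * 3) / 3)   ≡⟨ cong (2 *_) (+-distrib-/-∣ʳ N (n∣m*n m)) ⟩
  2 * (N / 3 + m * 3 / 3) ≡⟨ cong (λ k → 2 * (N / 3 + k)) (m*n/n≡m m 3) ⟩
  2 * (N / 3 + m)         ≡⟨ *-distribˡ-+ 2 (N / 3) m ⟩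
  rest N + 2 * m          ∎
  where open ≡-Reasoning

greedySum-+-3* : ∀ f N m → greedySum (suc f) (N + 3 * m) ≡ N % 3 + greedySum f (rest N + 2 * m)
greedySum-+-3* f N m = cong₂ _+_
  (trans (cong (λ k → (N + k) % 3) (*-comm 3 m)) ([m+kn]%n≡m%n N m 3))
  (cong (greedySum f) (rest-+-3* N m))

greedySum-+-3^* : ∀ K f N x →
  greedySum (K + f) (N + 3 ^ K * x) ≡ greedySum K N + greedySum f (iterate rest N K + 2 ^ K * x)
greedySum-+-3^* zero    f N x = refl
greedySum-+-3^* (suc K) f N x = begin
    greedySum (suc K + f) (N + 3 ^ suc K * x)
  ≡⟨ cong (λ k → greedySum (suc K + f) (N + k)) (*-assoc 3 (3 ^ K) x) ⟩
    greedySum (suc (K + f)) (N + 3 * (3 ^ K * x))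
  ≡⟨ greedySum-+-3* (K + f) N (3 ^ K * x) ⟩
    N % 3 + greedySum (K + f) (rest N + 2 * (3 ^ K * x))
  ≡⟨ cong (λ k → N % 3 + greedySum (K + f) (rest N + k)) (x∙yz≈y∙xz 2 (3 ^ K) x) ⟩
    N % 3 + greedySum (K + f) (rest N + 3 ^ K * (2 * x))
  ≡⟨ cong (_+_ (N % 3)) (greedySum-+-3^* K f (rest N) (2 * x)) ⟩
    N % 3 + (greedySum K (rest N) + greedySum f (iterate rest (rest N) K + 2 ^ K * (2 * x)))
  ≡⟨ +-assoc (N % 3) _ _ ⟨
    greedySum (suc K) N + greedySum f (iterate rest (rest N) K + 2 ^ K * (2 * x))
  ≡⟨ cong (λ k → greedySum (suc K) N + greedySum f (iterate rest (rest N) K + k))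
          (x∙yz≈yx∙z (2 ^ K) 2 x) ⟩
    greedySum (suc K) N + greedySum f (iterate rest N (suc K) + 2 ^ suc K * x)
  ∎
  where open ≡-Reasoning

isOdd : Parity → Bool
isOdd 0ℙ = false
isOdd 1ℙ = true

parity≡isOdd∘parity : ∀ n → parity n ≡ isOdd (ℕ.parity n)
parity≡isOdd∘parity zero          = refl
parity≡isOdd∘parity (suc zero)    = refl
parity≡isOdd∘parity (suc (suc n)) = parity≡isOdd∘parity n

isOdd-+ : ∀ p q → isOdd (p ℙ.+ q) ≡ isOdd p xor isOdd q
isOdd-+ 0ℙ q  = refl
isOdd-+ 1ℙ 0ℙ = refl
isOdd-+ 1ℙ 1ℙ = refl

parity-+ : ∀ m n → parity (m + n) ≡ parity m xor parity n
parity-+ m n = begin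
  parity (m + n)                                ≡⟨ parity≡isOdd∘parity (m + n) ⟩
  isOdd (ℕ.parity (m + n))                      ≡⟨ cong isOdd (+-homo-+ m n) ⟩
  isOdd (ℕ.parity m ℙ.+ ℕ.parity n)             ≡⟨ isOdd-+ (ℕ.parity m) (ℕ.parity n) ⟩
  isOdd (ℕ.parity m) xor isOdd (ℕ.parity n)     ≡⟨ cong₂ _xor_ (parity≡isOdd∘parity m) (parity≡isOdd∘parity n) ⟨
  parity m xor parity n                         ∎
  where open ≡-Reasoning

3^-odd : ∀ K → ∃ λ c → 3 ^ K ≡ suc (2 * c)
3^-odd zero = 0 , refl
3^-odd (suc K) with 3^-odd K
... | c , 3^K≡1+2c = 3 * c + 1 , trans (cong (3 *_) 3^K≡1+2c) (ℕ-Solver.solve (c ∷ []))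

1+odd*x≡2^K*y : ∀ c K → ∃ λ x → ∃ λ y → 1 + suc (2 * c) * x ≡ 2 ^ K * y
1+odd*x≡2^K*y c zero = 0 , 1 , cong suc (*-zeroʳ (suc (2 * c)))
1+odd*x≡2^K*y c (suc K) with 1+odd*x≡2^K*y c K
... | x , y , e with y divMod 2
...   | result q Fin.zero            y≡2q   =
  x , q , trans e (trans (cong (2 ^ K *_) y≡2q) (regroup (2 ^ K) q))
  where
  regroup : ∀ P q → P * (q * 2) ≡ 2 * P * q
  regroup = ℕ-Solver.solve-∀
...   | result q (Fin.suc Fin.zero) y≡1+2q = x + P , q + c + 1 , (begin
    1 + a * (x + P)         ≡⟨ cong suc (*-distribˡ-+ a x P) ⟩
    (1 + a * x) + a * P     ≡⟨ cong (_+ a * P) (trans e (cong (P *_) y≡1+2q)) ⟩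
    P * (1 + q * 2) + a * P ≡⟨ regroup P q c ⟩
    2 * P * (q + c + 1)     ∎)
  where
  open ≡-Reasoning
  a P : ℕ
  a = suc (2 * c)
  P = 2 ^ K
  regroup : ∀ P q c → P * (1 + q * 2) + suc (2 * c) * P ≡ 2 * P * (q + c + 1)
  regroup = ℕ-Solver.solve-∀

1+3^K*x≡2^K*y : ∀ K → ∃ λ x → ∃ λ y → 1 + 3 ^ K * x ≡ 2 ^ K * y
1+3^K*x≡2^K*y K with 3^-odd K
... | c , 3^K≡1+2c with 1+odd*x≡2^K*y c K
...   | x , y , e = x , y , trans (cong (λ a → 1 + a * x) 3^K≡1+2c) e

module _ (t : ℕ → Bool) (isT : IsT t) where

  T≡parity∘greedySum : ∀ f M → M ≤ f → t M ≡ parity (greedySum f M)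
  T≡parity∘greedySum f M M≤f = begin
    t M                                  ≡⟨ isT M (greedyDigits f M) rep ⟩
    parity (digitSum (greedyDigits f M)) ≡⟨ cong parity (digitSum-greedyDigits f M) ⟩
    parity (greedySum f M)               ∎
    where
    open ≡-Reasoning
    rep : IsRep (greedyDigits f M) M
    rep = greedyDigits-isRep f M (iterate-rest-vanishes f M M≤f)

  T-+-3^* : ∀ K N x → N ≤ K → t (N + 3 ^ K * x) ≡ t N xor t (2 ^ K * x)
  T-+-3^* K N x N≤K = begin
      t (N + 3 ^ K * x)
    ≡⟨ T≡parity∘greedySum (K + f) (N + 3 ^ K * x) (≤-trans (m≤m+n _ (2 ^ K * x)) (m≤n+m f K)) ⟩
      parity (greedySum (K + f) (N + 3 ^ K * x))
    ≡⟨ cong parity (greedySum-+-3^* K f N x) ⟩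
      parity (greedySum K N + greedySum f (iterate rest N K + 2 ^ K * x))
    ≡⟨ cong (λ r → parity (greedySum K N + greedySum f (r + 2 ^ K * x))) (iterate-rest-vanishes K N N≤K) ⟩
      parity (greedySum K N + greedySum f (2 ^ K * x))
    ≡⟨ parity-+ (greedySum K N) _ ⟩
      parity (greedySum K N) xor parity (greedySum f (2 ^ K * x))
    ≡⟨ cong₂ _xor_ (T≡parity∘greedySum K N N≤K) (T≡parity∘greedySum f (2 ^ K * x) (m≤n+m _ (N + 3 ^ K * x))) ⟨
      t N xor t (2 ^ K * x)
    ∎
    where
    open ≡-Reasoning
    f : ℕ
    f = N + 3 ^ K * x + 2 ^ K * x

  T-1 : t 1 ≡ true
  T-1 = T≡parity∘greedySum 1 1 ≤-refl

  T[2^K*z]≡true : ∀ K → 1 ≤ K → ∃ λ z → t (2 ^ K * z) ≡ true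
  T[2^K*z]≡true K 1≤K with 1+3^K*x≡2^K*y K
  ... | x , y , 1+3^Kx≡2^Ky with t (2 ^ K * x) in tx
  ...   | true  = x , tx
  ...   | false = y , (begin
    t (2 ^ K * y)           ≡⟨ cong t 1+3^Kx≡2^Ky ⟨
    t (1 + 3 ^ K * x)       ≡⟨ T-+-3^* K 1 x 1≤K ⟩
    t 1 xor t (2 ^ K * x)   ≡⟨ cong₂ _xor_ T-1 tx ⟩
    true                    ∎)
    where open ≡-Reasoning

  T-antiperiod : ∀ B → ∃ λ S → ∀ N → N < B → t (N + S) ≡ not (t N)
  T-antiperiod B with T[2^K*z]≡true (suc B) (s≤s z≤n)
  ... | z , tz = 3 ^ suc B * z , λ N N<B → begin
    t (N + 3 ^ suc B * z)         ≡⟨ T-+-3^* (suc B) N z (m≤n⇒m≤1+n (<⇒≤ N<B)) ⟩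
    t N xor t (2 ^ suc B * z)     ≡⟨ cong (t N xor_) tz ⟩
    t N xor true                  ≡⟨ xor-comm (t N) true ⟩
    not (t N)                     ∎
    where open ≡-Reasoning

complement-shift : (t : ℕ → Bool) (S B : ℕ) → (∀ N → N < B → t (N + S) ≡ not (t N)) →
  (w : List Bool) (p : Occurs w t) → proj₁ p + length w ≤ B →
  Σ (Occurs (complement w) t) (λ q → proj₁ q ≡ proj₁ p + S)
complement-shift t S B flip []       (j , tt)         _        = (j + S , tt) , refl
complement-shift t S B flip (b ∷ bs) (j , tj≡b , occ) j+|w|≤B
  with complement-shift t S B flip bs (suc j , occ) (subst (_≤ B) (+-suc j (length bs)) j+|w|≤B)
... | (._ , occ′) , refl =
  (j + S , trans (flip j (<-≤-trans (m<m+n j z<s) j+|w|≤B)) (cong not tj≡b) , occ′) , refl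

proposition3 : (t : ℕ → Bool) → IsT t →
    (w : List Bool) → Occurs w t → Occurs (complement w) t
proposition3 t isT w p@(j , _) =
  let S , flip = T-antiperiod t isT (j + length w)
  in  proj₁ (complement-shift t S (j + length w) flip w p ≤-refl)
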